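{- Let $I$ be a small category and let $(\mathcal{L}(i))_{i \in I}$ be a family of complete Heyting algebras. Then the category $\mathbf{FuzzyPresheaf}(I,\mathcal{L})$ is rm-adhesive.
   Context: Given a category $I$ and a family of posets $(\mathcal{L}(i),\leq)_{i\in I}$, an $\mathcal{L}$-fuzzy presheaf is a pair $(A,\alpha)$ where $A: I^{op}\to \mathbf{Set}$ is a functor and $\alpha$ is a family of functions $\alpha_i : A(i)\to \mathcal{L}(i)$, $i\in I$. A morphism $f:(A,\alpha)\to(B,\beta)$ is a natural transformation $f:A\to B$ with $\alpha_i \leq \beta_i f_i$ pointwise for all $i$. These form $\mathbf{FuzzyPresheaf}(I,\mathcal{L})$. A pushout square $ABCD$ (with $B\to A$, $B\to C$, $A\to D$, $C\to D$) is Van Kampen if, whenever it is the bottom face of a commutative cube whose two back faces (those containing $B\to A$ and $B\to C$) are pullbacks, the two front faces are pullbacks if and only if the top face is a pushout. A category is rm-adhesive if pushouts along regular monomorphisms exist and are Van Kampen. -}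

module Defs where

open import Level using (Level; _⊔_; 0ℓ) renaming (suc to lsuc)
open import Data.Product using (Σ; _×_; _,_; proj₁; proj₂)
open import Function.Bundles using (Func; _⇔_)
open import Relation.Binary using (Rel; IsEquivalence; Setoid)
open import Relation.Binary.Lattice.Bundles using (HeytingAlgebra)

record Category (o ℓ e : Level) : Set (lsuc (o ⊔ ℓ ⊔ e)) where
  infix  4 _≈_
  infixr 9 _∘_
  field
    Obj       : Set o
    _⇒_       : Obj → Obj → Set ℓ
    _≈_       : ∀ {A B} → Rel (A ⇒ B) e
    id        : ∀ {A} → A ⇒ A
    _∘_       : ∀ {A B C} → B ⇒ C → A ⇒ B → A ⇒ C
    equiv     : ∀ {A B} → IsEquivalence (_≈_ {A} {B})
    ∘-resp-≈  : ∀ {A B C} {f h : B ⇒ C} {g i : A ⇒ B} → f ≈ h → g ≈ i → f ∘ g ≈ h ∘ i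
    assoc     : ∀ {A B C D} {f : A ⇒ B} {g : B ⇒ C} {h : C ⇒ D} →
                (h ∘ g) ∘ f ≈ h ∘ (g ∘ f)
    identityˡ : ∀ {A B} {f : A ⇒ B} → id ∘ f ≈ f
    identityʳ : ∀ {A B} {f : A ⇒ B} → f ∘ id ≈ f

module CatNotions {o ℓ e : Level} (𝒞 : Category o ℓ e) where
  open Category 𝒞

  IsEqualizer : ∀ {E A B} → E ⇒ A → A ⇒ B → A ⇒ B → Set (o ⊔ ℓ ⊔ e)
  IsEqualizer {E} {A} eq f g =
    (f ∘ eq ≈ g ∘ eq) ×
    (∀ {X} (h : X ⇒ A) → f ∘ h ≈ g ∘ h →
       Σ (X ⇒ E) λ u → (eq ∘ u ≈ h) × (∀ (u' : X ⇒ E) → eq ∘ u' ≈ h → u' ≈ u))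

  RegularMono : ∀ {B A} → B ⇒ A → Set (o ⊔ ℓ ⊔ e)
  RegularMono {B} {A} m = Σ Obj λ C → Σ (A ⇒ C) λ f → Σ (A ⇒ C) λ g → IsEqualizer m f g

  IsPullback : ∀ {P A B C} → P ⇒ A → P ⇒ B → A ⇒ C → B ⇒ C → Set (o ⊔ ℓ ⊔ e)
  IsPullback {P} {A} {B} {C} p₁ p₂ f g =
    (f ∘ p₁ ≈ g ∘ p₂) ×
    (∀ {X} (h₁ : X ⇒ A) (h₂ : X ⇒ B) → f ∘ h₁ ≈ g ∘ h₂ →
       Σ (X ⇒ P) λ u → (p₁ ∘ u ≈ h₁) × (p₂ ∘ u ≈ h₂) ×
         (∀ (u' : X ⇒ P) → p₁ ∘ u' ≈ h₁ → p₂ ∘ u' ≈ h₂ → u' ≈ u))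

  IsPushout : ∀ {A B C D} → B ⇒ A → B ⇒ C → A ⇒ D → C ⇒ D → Set (o ⊔ ℓ ⊔ e)
  IsPushout {A} {B} {C} {D} m g i j =
    (i ∘ m ≈ j ∘ g) ×
    (∀ {X} (h₁ : A ⇒ X) (h₂ : C ⇒ X) → h₁ ∘ m ≈ h₂ ∘ g →
       Σ (D ⇒ X) λ u → (u ∘ i ≈ h₁) × (u ∘ j ≈ h₂) ×
         (∀ (u' : D ⇒ X) → u' ∘ i ≈ h₁ → u' ∘ j ≈ h₂ → u' ≈ u))

  IsVanKampen : ∀ {A B C D} → B ⇒ A → B ⇒ C → A ⇒ D → C ⇒ D → Set (o ⊔ ℓ ⊔ e)
  IsVanKampen {A} {B} {C} {D} m g i j =
    ∀ {A' B' C' D'} (m' : B' ⇒ A') (g' : B' ⇒ C') (i' : A' ⇒ D') (j' : C' ⇒ D')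
      (a : A' ⇒ A) (b : B' ⇒ B) (c : C' ⇒ C) (d : D' ⇒ D) →
      i' ∘ m' ≈ j' ∘ g' →
      a ∘ m' ≈ m ∘ b →
      c ∘ g' ≈ g ∘ b →
      d ∘ i' ≈ i ∘ a →
      d ∘ j' ≈ j ∘ c →
      IsPullback m' b a m →
      IsPullback g' b c g →
      ((IsPullback i' a d i × IsPullback j' c d j) ⇔ IsPushout m' g' i' j')

  RmAdhesive : Set (o ⊔ ℓ ⊔ e)
  RmAdhesive =
    (∀ {A B C} (m : B ⇒ A) (g : B ⇒ C) → RegularMono m →
       Σ Obj λ D → Σ (A ⇒ D) λ i → Σ (C ⇒ D) λ j → IsPushout m g i j) ×
    (∀ {A B C D} (m : B ⇒ A) (g : B ⇒ C) (i : A ⇒ D) (j : C ⇒ D) →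
       RegularMono m → IsPushout m g i j → IsVanKampen m g i j)

record CompleteHeytingAlgebra (c ℓ₁ ℓ₂ : Level) : Set (lsuc (c ⊔ ℓ₁ ⊔ ℓ₂)) where
  field
    heytingAlgebra : HeytingAlgebra c ℓ₁ ℓ₂
  open HeytingAlgebra heytingAlgebra public
  field
    ⋁       : {J : Set c} → (J → Carrier) → Carrier
    ⋁-upper : {J : Set c} (x : J → Carrier) (k : J) → x k ≤ ⋁ x
    ⋁-least : {J : Set c} (x : J → Carrier) (y : Carrier) →
              (∀ k → x k ≤ y) → ⋁ x ≤ y

module _ (I : Category 0ℓ 0ℓ 0ℓ) (L : Category.Obj I → CompleteHeytingAlgebra 0ℓ 0ℓ 0ℓ) where
  private
    module I = Category I
    module L i = CompleteHeytingAlgebra (L i)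
  open Setoid using (Carrier)
  open Func

  record FuzzyPresheaf : Set₁ where
    field
      F₀       : I.Obj → Setoid 0ℓ 0ℓ
      F₁       : ∀ {i j} → j I.⇒ i → Func (F₀ i) (F₀ j)
      identity : ∀ {i} (x : Carrier (F₀ i)) → Setoid._≈_ (F₀ i) (to (F₁ I.id) x) x
      homomorphism : ∀ {i j k} (f : j I.⇒ i) (g : k I.⇒ j) (x : Carrier (F₀ i)) →
                     Setoid._≈_ (F₀ k) (to (F₁ (f I.∘ g)) x) (to (F₁ g) (to (F₁ f) x))
      F-resp-≈ : ∀ {i j} {f g : j I.⇒ i} → f I.≈ g → (x : Carrier (F₀ i)) →
                 Setoid._≈_ (F₀ j) (to (F₁ f) x) (to (F₁ g) x)
      α        : ∀ i → Carrier (F₀ i) → L.Carrier i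
      α-cong   : ∀ i {x y : Carrier (F₀ i)} → Setoid._≈_ (F₀ i) x y → L._≈_ i (α i x) (α i y)

  open FuzzyPresheaf

  record FuzzyHom (A B : FuzzyPresheaf) : Set where
    field
      η       : ∀ i → Func (F₀ A i) (F₀ B i)
      natural : ∀ {i j} (f : j I.⇒ i) (x : Carrier (F₀ A i)) →
                Setoid._≈_ (F₀ B j) (to (η j) (to (F₁ A f) x)) (to (F₁ B f) (to (η i) x))
      fuzzy   : ∀ i (x : Carrier (F₀ A i)) → L._≤_ i (α A i x) (α B i (to (η i) x))

  open FuzzyHom

  _≈H_ : ∀ {A B} → Rel (FuzzyHom A B) 0ℓ
  _≈H_ {A} {B} f g = ∀ i (x : Carrier (F₀ A i)) → Setoid._≈_ (F₀ B i) (to (η f i) x) (to (η g i) x)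

  idH : ∀ {A} → FuzzyHom A A
  idH {A} = record
    { η = λ i → record { to = λ x → x ; cong = λ p → p }
    ; natural = λ {i} {j} f x → Setoid.refl (F₀ A j)
    ; fuzzy = λ i x → L.refl i }

  _∘H_ : ∀ {A B C} → FuzzyHom B C → FuzzyHom A B → FuzzyHom A C
  _∘H_ {A} {B} {C} g f = record
    { η = λ i → record { to = λ x → to (η g i) (to (η f i) x)
                       ; cong = λ p → cong (η g i) (cong (η f i) p) }
    ; natural = λ {i} {j} h x → Setoid.trans (F₀ C j)
                  (cong (η g j) (natural f h x)) (natural g h (to (η f i) x))
    ; fuzzy = λ i x → L.trans i (fuzzy f i x) (fuzzy g i (to (η f i) x)) }

  FuzzyPresheafCat : Category (lsuc 0ℓ) 0ℓ 0ℓ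
  FuzzyPresheafCat = record
    { Obj = FuzzyPresheaf
    ; _⇒_ = FuzzyHom
    ; _≈_ = _≈H_
    ; id = idH
    ; _∘_ = _∘H_
    ; equiv = λ {A} {B} → record
        { refl = λ i x → Setoid.refl (F₀ B i)
        ; sym = λ p i x → Setoid.sym (F₀ B i) (p i x)
        ; trans = λ p q i x → Setoid.trans (F₀ B i) (p i x) (q i x) }
    ; ∘-resp-≈ = λ {A} {B} {C} {f} {h} {g} {k} p q i x →
        Setoid.trans (F₀ C i) (p i (to (η g i) x)) (cong (η h i) (q i x))
    ; assoc = λ {A} {B} {C} {D} i x → Setoid.refl (F₀ D i)
    ; identityˡ = λ {A} {B} i x → Setoid.refl (F₀ B i)
    ; identityʳ = λ {A} {B} i x → Setoid.refl (F₀ B i)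
    }

-- Pullbacks, and pushouts along injective maps, of fuzzy presheaves are computed
-- on elements: a pullback is the pullback of the underlying presheaves fuzzified by
-- the meet α_A ∧ α_B, and a pushout along an injective m is A ⊎ C modulo the gluing
-- relation m b ∼ g b, each element fuzzified by the join of the fuzziness of its
-- preimages. Regular monos are injective and carry the fuzziness induced from their
-- codomain, and both properties are stable under pullback. The Van Kampen property
-- therefore reduces to the familiar elementwise argument for presheaves of sets,
-- together with one lattice computation: the meets in the front faces agree with the
-- joins in the top face because x ∧ - preserves joins in a complete Heyting algebra.
module Submission where

open import Defs
open import Level using (0ℓ)
open import Data.Product using (Σ; _×_; _,_; proj₁; proj₂)
open import Data.Sum using (_⊎_; inj₁; inj₂)
open import Function.Bundles using (Func; mk⇔)
open import Relation.Binary using (Setoid; IsEquivalence)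

module _ (I : Category 0ℓ 0ℓ 0ℓ)
         (L : Category.Obj I → CompleteHeytingAlgebra 0ℓ 0ℓ 0ℓ) where
  private
    module I = Category I
    module L {i : I.Obj} where
      open CompleteHeytingAlgebra (L i) public
      open import Relation.Binary.Lattice.Properties.MeetSemilattice meetSemilattice public
        using (∧-monotonic)
      open import Relation.Binary.Lattice.Properties.HeytingAlgebra heytingAlgebra public
        using (swap-transpose-⇨)

  open FuzzyPresheaf
  open FuzzyHom
  open Category (FuzzyPresheafCat I L) using (_≈_; _∘_; id)
  open CatNotions (FuzzyPresheafCat I L)

  PSh : Set₁
  PSh = FuzzyPresheaf I L

  Hom : PSh → PSh → Set
  Hom = FuzzyHom I L

  ∣_∣ : PSh → I.Obj → Set
  ∣ X ∣ i = Setoid.Carrier (F₀ X i)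

  infix 4 _∋_≈_
  _∋_≈_ : (X : PSh) {i : I.Obj} → ∣ X ∣ i → ∣ X ∣ i → Set
  _∋_≈_ X {i} = Setoid._≈_ (F₀ X i)

  module El (X : PSh) {i : I.Obj} where
    open Setoid (F₀ X i) public using (refl; sym)

    infixr 5 _∙_
    _∙_ : {x y z : ∣ X ∣ i} → X ∋ x ≈ y → X ∋ y ≈ z → X ∋ x ≈ z
    _∙_ = Setoid.trans (F₀ X i)

    ≈⇒α≤ : {x y : ∣ X ∣ i} → X ∋ x ≈ y → α X i x L.≤ α X i y
    ≈⇒α≤ p = L.reflexive (α-cong X i p)

  infixr 9 _⟨$⟩_
  _⟨$⟩_ : ∀ {X Y} → Hom X Y → ∀ {i} → ∣ X ∣ i → ∣ Y ∣ i
  f ⟨$⟩ x = Func.to (η f _) x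

  cong : ∀ {X Y} (f : Hom X Y) {i} {x y : ∣ X ∣ i} → X ∋ x ≈ y → Y ∋ f ⟨$⟩ x ≈ f ⟨$⟩ y
  cong f = Func.cong (η f _)

  res : ∀ X {i j} → j I.⇒ i → ∣ X ∣ i → ∣ X ∣ j
  res X h = Func.to (F₁ X h)

  res-cong : ∀ X {i j} (h : j I.⇒ i) {x y : ∣ X ∣ i} → X ∋ x ≈ y → X ∋ res X h x ≈ res X h y
  res-cong X h = Func.cong (F₁ X h)

  natural-≈ : ∀ {X Y} (f : Hom X Y) {i j} (h : j I.⇒ i) {x : ∣ X ∣ i} {y : ∣ Y ∣ i} →
              Y ∋ f ⟨$⟩ x ≈ y → Y ∋ f ⟨$⟩ res X h x ≈ res Y h y
  natural-≈ {Y = Y} f h {x} p = natural f h x Y.∙ res-cong Y h p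
    where module Y = El Y

  -- The representable presheaf is given the least fuzziness, so that every
  -- element x ∈ X(i) is a morphism  element X x : よ i ⇒ X.
  よ : I.Obj → PSh
  よ i = record
    { F₀ = λ j → record { Carrier = j I.⇒ i ; _≈_ = I._≈_ ; isEquivalence = I.equiv }
    ; F₁ = λ h → record { to = λ f → f I.∘ h
                        ; cong = λ p → I.∘-resp-≈ p (IsEquivalence.refl I.equiv) }
    ; identity = λ _ → I.identityʳ
    ; homomorphism = λ _ _ _ → IsEquivalence.sym I.equiv I.assoc
    ; F-resp-≈ = λ p _ → I.∘-resp-≈ (IsEquivalence.refl I.equiv) p
    ; α = λ _ _ → L.⊥
    ; α-cong = λ _ _ → L.Eq.refl
    }

  element : ∀ X {i} → ∣ X ∣ i → Hom (よ i) X
  element X x = record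
    { η = λ _ → record { to = λ h → res X h x ; cong = λ p → F-resp-≈ X p x }
    ; natural = λ h f → homomorphism X f h x
    ; fuzzy = λ _ _ → L.minimum _
    }

  element-injective : ∀ X {i} {x y : ∣ X ∣ i} → element X x ≈ element X y → X ∋ x ≈ y
  element-injective X {i} {x} {y} p = X.sym (identity X x) X.∙ p i I.id X.∙ identity X y
    where module X = El X

  element-natural : ∀ {X Y} (f : Hom X Y) {i} {x : ∣ X ∣ i} {y : ∣ Y ∣ i} →
                    Y ∋ f ⟨$⟩ x ≈ y → f ∘ element X x ≈ element Y y
  element-natural f p _ h = natural-≈ f h p

  element-square : ∀ {A B C} (f : Hom A C) (g : Hom B C) {i} {a : ∣ A ∣ i} {b : ∣ B ∣ i} →
                   C ∋ f ⟨$⟩ a ≈ g ⟨$⟩ b → f ∘ element A a ≈ g ∘ element B b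
  element-square {C = C} f g p _ h = natural-≈ f h p C.∙ C.sym (natural-≈ g h C.refl)
    where module C = El C

  Injective : ∀ {B A} → Hom B A → Set
  Injective {B} {A} m = ∀ {i} {x y : ∣ B ∣ i} → A ∋ m ⟨$⟩ x ≈ m ⟨$⟩ y → B ∋ x ≈ y

  ReflectsFuzziness : ∀ {B A} → Hom B A → Set
  ReflectsFuzziness {B} {A} m = ∀ {i} (x : ∣ B ∣ i) → α A i (m ⟨$⟩ x) L.≤ α B i x

  -- The superscript ᵉ marks the elementwise form of a universal property.
  record IsPullbackᵉ {P A B C : PSh} (p₁ : Hom P A) (p₂ : Hom P B) (f : Hom A C) (g : Hom B C) :
                     Set where
    field
      commutes          : ∀ {i} (x : ∣ P ∣ i) → C ∋ f ⟨$⟩ p₁ ⟨$⟩ x ≈ g ⟨$⟩ p₂ ⟨$⟩ x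
      jointly-injective : ∀ {i} (x y : ∣ P ∣ i) →
                          A ∋ p₁ ⟨$⟩ x ≈ p₁ ⟨$⟩ y → B ∋ p₂ ⟨$⟩ x ≈ p₂ ⟨$⟩ y → P ∋ x ≈ y
      pair              : ∀ {i} (a : ∣ A ∣ i) (b : ∣ B ∣ i) → C ∋ f ⟨$⟩ a ≈ g ⟨$⟩ b →
                          Σ (∣ P ∣ i) λ x → A ∋ p₁ ⟨$⟩ x ≈ a × B ∋ p₂ ⟨$⟩ x ≈ b
      α-meet            : ∀ {i} (x : ∣ P ∣ i) → α A i (p₁ ⟨$⟩ x) L.∧ α B i (p₂ ⟨$⟩ x) L.≤ α P i x

  module _ {P A B C : PSh} {p₁ : Hom P A} {p₂ : Hom P B} {f : Hom A C} {g : Hom B C} where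
    private
      module P = El P
      module A = El A
      module B = El B

    IsPullback⇒ᵉ : IsPullback p₁ p₂ f g → IsPullbackᵉ p₁ p₂ f g
    IsPullback⇒ᵉ (square , universal) = record
      { commutes          = λ {i} → square i
      ; jointly-injective = jointly-injective
      ; pair              = pair
      ; α-meet            = α-meet
      }
      where
      jointly-injective : ∀ {i} (x y : ∣ P ∣ i) →
                          A ∋ p₁ ⟨$⟩ x ≈ p₁ ⟨$⟩ y → B ∋ p₂ ⟨$⟩ x ≈ p₂ ⟨$⟩ y → P ∋ x ≈ y
      jointly-injective {i} x y p q =
        let (_ , _ , _ , unique) = universal (element A (p₁ ⟨$⟩ x)) (element B (p₂ ⟨$⟩ x))
                                             (element-square f g (square i x))
            x≈u = unique (element P x) (element-natural p₁ A.refl) (element-natural p₂ B.refl)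
            y≈u = unique (element P y) (element-natural p₁ (A.sym p)) (element-natural p₂ (B.sym q))
        in element-injective P (λ j h → x≈u j h P.∙ P.sym (y≈u j h))

      pair : ∀ {i} (a : ∣ A ∣ i) (b : ∣ B ∣ i) → C ∋ f ⟨$⟩ a ≈ g ⟨$⟩ b →
             Σ (∣ P ∣ i) λ x → A ∋ p₁ ⟨$⟩ x ≈ a × B ∋ p₂ ⟨$⟩ x ≈ b
      pair {i} a b e =
        let (u , p₁u , p₂u , _) = universal (element A a) (element B b) (element-square f g e)
        in u ⟨$⟩ I.id , p₁u i I.id A.∙ identity A a , p₂u i I.id B.∙ identity B b

      P∧ : PSh
      P∧ = record P
        { α      = λ i x → α A i (p₁ ⟨$⟩ x) L.∧ α B i (p₂ ⟨$⟩ x)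
        ; α-cong = λ i e → L.antisym
            (L.∧-monotonic (A.≈⇒α≤ (cong p₁ e)) (B.≈⇒α≤ (cong p₂ e)))
            (L.∧-monotonic (A.≈⇒α≤ (cong p₁ (P.sym e))) (B.≈⇒α≤ (cong p₂ (P.sym e))))
        }

      q₁ : Hom P∧ A
      q₁ = record { η = η p₁ ; natural = natural p₁ ; fuzzy = λ _ _ → L.x∧y≤x _ _ }

      q₂ : Hom P∧ B
      q₂ = record { η = η p₂ ; natural = natural p₂ ; fuzzy = λ _ _ → L.x∧y≤y _ _ }

      α-meet : ∀ {i} (x : ∣ P ∣ i) → α A i (p₁ ⟨$⟩ x) L.∧ α B i (p₂ ⟨$⟩ x) L.≤ α P i x
      α-meet {i} x =
        let (u , p₁u , p₂u , _) = universal q₁ q₂ square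
        in L.trans (fuzzy u i x) (P.≈⇒α≤ (jointly-injective (u ⟨$⟩ x) x (p₁u i x) (p₂u i x)))

    ᵉ⇒IsPullback : IsPullbackᵉ p₁ p₂ f g → IsPullback p₁ p₂ f g
    ᵉ⇒IsPullback pb = (λ _ → commutes) , universal
      where
      open IsPullbackᵉ pb

      universal : ∀ {X} (h₁ : Hom X A) (h₂ : Hom X B) → f ∘ h₁ ≈ g ∘ h₂ →
                  Σ (Hom X P) λ u → (p₁ ∘ u ≈ h₁) × (p₂ ∘ u ≈ h₂) ×
                    (∀ (u' : Hom X P) → p₁ ∘ u' ≈ h₁ → p₂ ∘ u' ≈ h₂ → u' ≈ u)
      universal {X} h₁ h₂ e = u , (λ _ → pairing-p₁) , (λ _ → pairing-p₂) ,
                              λ _ p q _ x → ≈pairing (p _ x) (q _ x)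
        where
        pairing : ∀ {i} → ∣ X ∣ i → ∣ P ∣ i
        pairing x = proj₁ (pair (h₁ ⟨$⟩ x) (h₂ ⟨$⟩ x) (e _ x))

        pairing-p₁ : ∀ {i} (x : ∣ X ∣ i) → A ∋ p₁ ⟨$⟩ pairing x ≈ h₁ ⟨$⟩ x
        pairing-p₁ x = proj₁ (proj₂ (pair (h₁ ⟨$⟩ x) (h₂ ⟨$⟩ x) (e _ x)))

        pairing-p₂ : ∀ {i} (x : ∣ X ∣ i) → B ∋ p₂ ⟨$⟩ pairing x ≈ h₂ ⟨$⟩ x
        pairing-p₂ x = proj₂ (proj₂ (pair (h₁ ⟨$⟩ x) (h₂ ⟨$⟩ x) (e _ x)))

        ≈pairing : ∀ {i} {x : ∣ X ∣ i} {y : ∣ P ∣ i} →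
                   A ∋ p₁ ⟨$⟩ y ≈ h₁ ⟨$⟩ x → B ∋ p₂ ⟨$⟩ y ≈ h₂ ⟨$⟩ x → P ∋ y ≈ pairing x
        ≈pairing {x = x} p q =
          jointly-injective _ _ (p A.∙ A.sym (pairing-p₁ x)) (q B.∙ B.sym (pairing-p₂ x))

        u : Hom X P
        u = record
          { η       = λ _ → record
              { to   = pairing
              ; cong = λ {x} p →
                  ≈pairing (pairing-p₁ x A.∙ cong h₁ p) (pairing-p₂ x B.∙ cong h₂ p) }
          ; natural = λ h x → P.sym (≈pairing
              (natural-≈ p₁ h (pairing-p₁ x) A.∙ A.sym (natural h₁ h x))
              (natural-≈ p₂ h (pairing-p₂ x) B.∙ B.sym (natural h₂ h x)))
          ; fuzzy   = λ i x → L.trans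
              (L.∧-greatest (fuzzy h₁ i x) (fuzzy h₂ i x))
              (L.trans (L.∧-monotonic (A.≈⇒α≤ (A.sym (pairing-p₁ x)))
                                      (B.≈⇒α≤ (B.sym (pairing-p₂ x))))
                       (α-meet (pairing x)))
          }

  [_,_] : ∀ {A C X} → Hom A X → Hom C X → ∀ {i} → ∣ A ∣ i ⊎ ∣ C ∣ i → ∣ X ∣ i
  [ h₁ , h₂ ] (inj₁ a) = h₁ ⟨$⟩ a
  [ h₁ , h₂ ] (inj₂ c) = h₂ ⟨$⟩ c

  module Span {A B C : PSh} (m : Hom B A) (g : Hom B C) where
    private
      module A = El A
      module C = El C

    Sum : I.Obj → Set
    Sum i = ∣ A ∣ i ⊎ ∣ C ∣ i

    α⊎ : ∀ {i} → Sum i → L.Carrier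
    α⊎ {i} (inj₁ a) = α A i a
    α⊎ {i} (inj₂ c) = α C i c

    res⊎ : ∀ {i j} → j I.⇒ i → Sum i → Sum j
    res⊎ h (inj₁ a) = inj₁ (res A h a)
    res⊎ h (inj₂ c) = inj₂ (res C h c)

    Glued : ∀ {i} → ∣ A ∣ i → ∣ C ∣ i → Set
    Glued {i} a c = Σ (∣ B ∣ i) λ b → A ∋ m ⟨$⟩ b ≈ a × C ∋ g ⟨$⟩ b ≈ c

    glued-respˡ : ∀ {i} {a a' : ∣ A ∣ i} {c} → A ∋ a ≈ a' → Glued a c → Glued a' c
    glued-respˡ p (b , mb , gb) = b , mb A.∙ p , gb

    glued-respʳ : ∀ {i} {a : ∣ A ∣ i} {c c'} → C ∋ c ≈ c' → Glued a c → Glued a c'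
    glued-respʳ p (b , mb , gb) = b , mb , gb C.∙ p

    glued-restrict : ∀ {i j} (h : j I.⇒ i) {a c} → Glued a c → Glued (res A h a) (res C h c)
    glued-restrict h (b , mb , gb) = res B h b , natural-≈ m h mb , natural-≈ g h gb

    -- When m is injective this is the equivalence relation generated by  m b ∼ g b,
    -- i.e. the kernel of  A ⊎ C → A +_B C.
    infix 4 _∼_
    _∼_ : ∀ {i} → Sum i → Sum i → Set
    _∼_ {i} (inj₁ a) (inj₁ a') = A ∋ a ≈ a' ⊎ Σ (∣ C ∣ i) λ c → Glued a c × Glued a' c
    inj₁ a ∼ inj₂ c  = Glued a c
    inj₂ c ∼ inj₁ a  = Glued a c
    inj₂ c ∼ inj₂ c' = C ∋ c ≈ c'

    ∼-refl : ∀ {i} {z : Sum i} → z ∼ z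
    ∼-refl {z = inj₁ _} = inj₁ A.refl
    ∼-refl {z = inj₂ _} = C.refl

    ∼-sym : ∀ {i} {z z' : Sum i} → z ∼ z' → z' ∼ z
    ∼-sym {z = inj₁ _} {inj₁ _} (inj₁ p)              = inj₁ (A.sym p)
    ∼-sym {z = inj₁ _} {inj₁ _} (inj₂ (c , gl , gl')) = inj₂ (c , gl' , gl)
    ∼-sym {z = inj₁ _} {inj₂ _} gl                    = gl
    ∼-sym {z = inj₂ _} {inj₁ _} gl                    = gl
    ∼-sym {z = inj₂ _} {inj₂ _} p                     = C.sym p

    ∼-restrict : ∀ {i j} (h : j I.⇒ i) {z z' : Sum i} → z ∼ z' → res⊎ h z ∼ res⊎ h z'
    ∼-restrict h {inj₁ _} {inj₁ _} (inj₁ p)              = inj₁ (res-cong A h p)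
    ∼-restrict h {inj₁ _} {inj₁ _} (inj₂ (c , gl , gl')) =
      inj₂ (res C h c , glued-restrict h gl , glued-restrict h gl')
    ∼-restrict h {inj₁ _} {inj₂ _} gl = glued-restrict h gl
    ∼-restrict h {inj₂ _} {inj₁ _} gl = glued-restrict h gl
    ∼-restrict h {inj₂ _} {inj₂ _} p  = res-cong C h p

    module _ {X : PSh} (h₁ : Hom A X) (h₂ : Hom C X) (cocone : h₁ ∘ m ≈ h₂ ∘ g) where
      private module X = El X

      glued-coequalised : ∀ {i} {a : ∣ A ∣ i} {c} → Glued a c → X ∋ h₁ ⟨$⟩ a ≈ h₂ ⟨$⟩ c
      glued-coequalised (b , mb , gb) = X.sym (cong h₁ mb) X.∙ cocone _ b X.∙ cong h₂ gb

      [,]-resp-∼ : ∀ {i} (z z' : Sum i) → z ∼ z' → X ∋ [ h₁ , h₂ ] z ≈ [ h₁ , h₂ ] z'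
      [,]-resp-∼ (inj₁ _) (inj₁ _) (inj₁ p)              = cong h₁ p
      [,]-resp-∼ (inj₁ _) (inj₁ _) (inj₂ (_ , gl , gl')) =
        glued-coequalised gl X.∙ X.sym (glued-coequalised gl')
      [,]-resp-∼ (inj₁ _) (inj₂ _) gl = glued-coequalised gl
      [,]-resp-∼ (inj₂ _) (inj₁ _) gl = X.sym (glued-coequalised gl)
      [,]-resp-∼ (inj₂ _) (inj₂ _) p  = cong h₂ p

    [,]-natural : ∀ {X} (h₁ : Hom A X) (h₂ : Hom C X) {i j} (h : j I.⇒ i) (z : Sum i) →
                  X ∋ [ h₁ , h₂ ] (res⊎ h z) ≈ res X h ([ h₁ , h₂ ] z)
    [,]-natural h₁ h₂ h (inj₁ a) = natural h₁ h a
    [,]-natural h₁ h₂ h (inj₂ c) = natural h₂ h c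

    [,]-fuzzy : ∀ {X} (h₁ : Hom A X) (h₂ : Hom C X) {i} (z : Sum i) →
                α⊎ z L.≤ α X i ([ h₁ , h₂ ] z)
    [,]-fuzzy h₁ h₂ (inj₁ a) = fuzzy h₁ _ a
    [,]-fuzzy h₁ h₂ (inj₂ c) = fuzzy h₂ _ c

    record IsPushoutᵉ {D : PSh} (ι : Hom A D) (κ : Hom C D) : Set where
      field
        commutes           : ∀ {i} (b : ∣ B ∣ i) → D ∋ ι ⟨$⟩ m ⟨$⟩ b ≈ κ ⟨$⟩ g ⟨$⟩ b
        jointly-surjective : ∀ {i} (d : ∣ D ∣ i) → Σ (Sum i) λ z → D ∋ [ ι , κ ] z ≈ d
        kernel⊆∼           : ∀ {i} (z z' : Sum i) → D ∋ [ ι , κ ] z ≈ [ ι , κ ] z' → z ∼ z'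
        α-join             : ∀ {i} (d : ∣ D ∣ i) (y : L.Carrier) →
                             (∀ z → D ∋ [ ι , κ ] z ≈ d → α⊎ z L.≤ y) → α D i d L.≤ y

    ᵉ⇒IsPushout : ∀ {D} {ι : Hom A D} {κ : Hom C D} → IsPushoutᵉ ι κ → IsPushout m g ι κ
    ᵉ⇒IsPushout {D} {ι} {κ} po = (λ _ → commutes) , universal
      where
      open IsPushoutᵉ po
      module D = El D

      universal : ∀ {X} (h₁ : Hom A X) (h₂ : Hom C X) → h₁ ∘ m ≈ h₂ ∘ g →
                  Σ (Hom D X) λ u → (u ∘ ι ≈ h₁) × (u ∘ κ ≈ h₂) ×
                    (∀ (u' : Hom D X) → u' ∘ ι ≈ h₁ → u' ∘ κ ≈ h₂ → u' ≈ u)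
      universal {X} h₁ h₂ cocone =
        u , (λ _ a → copairing-spec (inj₁ a) D.refl) , (λ _ c → copairing-spec (inj₂ c) D.refl) ,
        λ u' p q _ d → let (z , e) = jointly-surjective d
                       in X.sym (cong u' e) X.∙ u'-spec u' p q z X.∙ X.sym (copairing-spec z e)
        where
        module X = El X

        copairing : ∀ {i} → ∣ D ∣ i → ∣ X ∣ i
        copairing d = [ h₁ , h₂ ] (proj₁ (jointly-surjective d))

        copairing-spec : ∀ {i} {d : ∣ D ∣ i} (z : Sum i) → D ∋ [ ι , κ ] z ≈ d →
                         X ∋ copairing d ≈ [ h₁ , h₂ ] z
        copairing-spec {d = d} z e =
          let (z₀ , e₀) = jointly-surjective d
          in [,]-resp-∼ h₁ h₂ cocone z₀ z (kernel⊆∼ z₀ z (e₀ D.∙ D.sym e))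

        u'-spec : ∀ (u' : Hom D X) → u' ∘ ι ≈ h₁ → u' ∘ κ ≈ h₂ →
                  ∀ {i} (z : Sum i) → X ∋ u' ⟨$⟩ [ ι , κ ] z ≈ [ h₁ , h₂ ] z
        u'-spec u' p q (inj₁ a) = p _ a
        u'-spec u' p q (inj₂ c) = q _ c

        u : Hom D X
        u = record
          { η       = λ _ → record
              { to   = copairing
              ; cong = λ {_} {d'} p →
                  let (z , e) = jointly-surjective d' in copairing-spec z (e D.∙ D.sym p) }
          ; natural = λ h d → let (z , e) = jointly-surjective d in
              copairing-spec (res⊎ h z) ([,]-natural ι κ h z D.∙ res-cong D h e)
              X.∙ [,]-natural h₁ h₂ h z
          ; fuzzy   = λ i d → α-join d _ λ z e →
              L.trans ([,]-fuzzy h₁ h₂ z) (X.≈⇒α≤ (X.sym (copairing-spec z e)))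
          }

    module Gluing (m-injective : Injective m) where

      glued-functional : ∀ {i} {a : ∣ A ∣ i} {c c'} → Glued a c → Glued a c' → C ∋ c ≈ c'
      glued-functional (b , mb , gb) (b' , mb' , gb') =
        C.sym gb C.∙ cong g (m-injective (mb A.∙ A.sym mb')) C.∙ gb'

      ∼-trans : ∀ {i} {z z' z'' : Sum i} → z ∼ z' → z' ∼ z'' → z ∼ z''
      ∼-trans {z = inj₁ _} {inj₁ _} {inj₁ _} (inj₁ p) (inj₁ q) = inj₁ (p A.∙ q)
      ∼-trans {z = inj₁ _} {inj₁ _} {inj₁ _} (inj₁ p) (inj₂ (c , gl' , gl'')) =
        inj₂ (c , glued-respˡ (A.sym p) gl' , gl'')
      ∼-trans {z = inj₁ _} {inj₁ _} {inj₁ _} (inj₂ (c , gl , gl')) (inj₁ q) =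
        inj₂ (c , gl , glued-respˡ q gl')
      ∼-trans {z = inj₁ _} {inj₁ _} {inj₁ _} (inj₂ (c , gl , gl')) (inj₂ (c' , gl'₁ , gl'')) =
        inj₂ (c , gl , glued-respʳ (glued-functional gl'₁ gl') gl'')
      ∼-trans {z = inj₁ _} {inj₁ _} {inj₂ _} (inj₁ p) gl' = glued-respˡ (A.sym p) gl'
      ∼-trans {z = inj₁ _} {inj₁ _} {inj₂ _} (inj₂ (c , gl , gl')) gl'' =
        glued-respʳ (glued-functional gl' gl'') gl
      ∼-trans {z = inj₁ _} {inj₂ _} {inj₁ _} gl gl'' = inj₂ (_ , gl , gl'')
      ∼-trans {z = inj₁ _} {inj₂ _} {inj₂ _} gl q = glued-respʳ q gl
      ∼-trans {z = inj₂ _} {inj₁ _} {inj₁ _} gl (inj₁ q) = glued-respˡ q gl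
      ∼-trans {z = inj₂ _} {inj₁ _} {inj₁ _} gl (inj₂ (c , gl' , gl'')) =
        glued-respʳ (glued-functional gl' gl) gl''
      ∼-trans {z = inj₂ _} {inj₁ _} {inj₂ _} gl gl'' = glued-functional gl gl''
      ∼-trans {z = inj₂ _} {inj₂ _} {inj₁ _} p gl'' = glued-respʳ (C.sym p) gl''
      ∼-trans {z = inj₂ _} {inj₂ _} {inj₂ _} p q = p C.∙ q

      αQ : ∀ i → Sum i → L.Carrier
      αQ i z = L.⋁ {J = Σ (Sum i) λ w → w ∼ z} (λ (w , _) → α⊎ w)

      αQ-mono : ∀ i {z z' : Sum i} → z ∼ z' → αQ i z L.≤ αQ i z'
      αQ-mono i {z} r = L.⋁-least _ _ λ (w , w∼z) →
        L.⋁-upper (λ (w , _) → α⊎ w) (w , ∼-trans {z = w} {z} w∼z r)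

      A+ᴮC : PSh
      A+ᴮC = record
        { F₀           = λ i → record
            { Carrier       = Sum i
            ; _≈_           = _∼_
            ; isEquivalence = record
                { refl  = λ {z} → ∼-refl {z = z}
                ; sym   = λ {z} {z'} → ∼-sym {z = z} {z'}
                ; trans = λ {z} {z'} {z''} → ∼-trans {z = z} {z'} {z''}
                }
            }
        ; F₁           = λ h → record { to = res⊎ h ; cong = λ {z} {z'} → ∼-restrict h {z} {z'} }
        ; identity     = λ { (inj₁ a) → inj₁ (identity A a) ; (inj₂ c) → identity C c }
        ; homomorphism = λ { f h (inj₁ a) → inj₁ (homomorphism A f h a)
                           ; f h (inj₂ c) → homomorphism C f h c }
        ; F-resp-≈     = λ { p (inj₁ a) → inj₁ (F-resp-≈ A p a) ; p (inj₂ c) → F-resp-≈ C p c }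
        ; α            = αQ
        ; α-cong       = λ i {z} {z'} r →
            L.antisym (αQ-mono i r) (αQ-mono i (∼-sym {z = z} {z'} r))
        }

      inl : Hom A A+ᴮC
      inl = record
        { η       = λ _ → record { to = inj₁ ; cong = inj₁ }
        ; natural = λ _ _ → inj₁ A.refl
        ; fuzzy   = λ _ a → L.⋁-upper (λ (w , _) → α⊎ w) (inj₁ a , inj₁ A.refl)
        }

      inr : Hom C A+ᴮC
      inr = record
        { η       = λ _ → record { to = inj₂ ; cong = λ p → p }
        ; natural = λ _ _ → C.refl
        ; fuzzy   = λ _ c → L.⋁-upper (λ (w , _) → α⊎ w) (inj₂ c , C.refl)
        }

      A+ᴮC-isPushoutᵉ : IsPushoutᵉ inl inr
      A+ᴮC-isPushoutᵉ = record
        { commutes           = λ b → b , A.refl , C.refl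
        ; jointly-surjective = λ { (inj₁ a) → inj₁ a , inj₁ A.refl ; (inj₂ c) → inj₂ c , C.refl }
        ; kernel⊆∼           = λ { (inj₁ _) (inj₁ _) r → r ; (inj₁ _) (inj₂ _) r → r
                                 ; (inj₂ _) (inj₁ _) r → r ; (inj₂ _) (inj₂ _) r → r }
        ; α-join             = λ d y bound → L.⋁-least _ _ λ
            { (inj₁ a , r) → bound (inj₁ a) r ; (inj₂ c , r) → bound (inj₂ c) r }
        }

      A+ᴮC-isPushout : IsPushout m g inl inr
      A+ᴮC-isPushout = ᵉ⇒IsPushout A+ᴮC-isPushoutᵉ

      pushout : Σ PSh λ D → Σ (Hom A D) λ ι → Σ (Hom C D) λ κ → IsPushout m g ι κ
      pushout = A+ᴮC , inl , inr , A+ᴮC-isPushout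

      IsPushout⇒ᵉ : ∀ {D} {ι : Hom A D} {κ : Hom C D} → IsPushout m g ι κ → IsPushoutᵉ ι κ
      -- D is identified with A +_B C through the comparison maps u and v.
      IsPushout⇒ᵉ {D} {ι} {κ} (square , universal) = record
        { commutes           = λ {i} → square i
        ; jointly-surjective = λ d → u ⟨$⟩ d , D.sym (v-spec (u ⟨$⟩ d)) D.∙ v∘u d
        ; kernel⊆∼           = λ z z' e →
            ∼-trans {z = z} (∼-sym {z = u ⟨$⟩ [ ι , κ ] z} {z} (u-spec z))
                    (∼-trans {z = u ⟨$⟩ [ ι , κ ] z} (cong u e) (u-spec z'))
        ; α-join             = λ {i} d y bound →
            L.trans (fuzzy u i d) (L.⋁-least _ _ λ (w , w∼ud) →
              bound w (D.sym (v-spec w) D.∙ cong v {x = w} {u ⟨$⟩ d} w∼ud D.∙ v∘u d))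
        }
        where
        module D = El D

        u : Hom D A+ᴮC
        u = proj₁ (universal inl inr (proj₁ A+ᴮC-isPushout))

        u-spec : ∀ {i} (z : Sum i) → u ⟨$⟩ [ ι , κ ] z ∼ z
        u-spec (inj₁ a) = proj₁ (proj₂ (universal inl inr (proj₁ A+ᴮC-isPushout))) _ a
        u-spec (inj₂ c) = proj₁ (proj₂ (proj₂ (universal inl inr (proj₁ A+ᴮC-isPushout)))) _ c

        v : Hom A+ᴮC D
        v = proj₁ (proj₂ A+ᴮC-isPushout ι κ square)

        v-spec : ∀ {i} (z : Sum i) → D ∋ v ⟨$⟩ z ≈ [ ι , κ ] z
        v-spec (inj₁ a) = proj₁ (proj₂ (proj₂ A+ᴮC-isPushout ι κ square)) _ a
        v-spec (inj₂ c) = proj₁ (proj₂ (proj₂ (proj₂ A+ᴮC-isPushout ι κ square))) _ c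

        v∘u∘[ι,κ] : ∀ {i} (z : Sum i) → D ∋ v ⟨$⟩ u ⟨$⟩ [ ι , κ ] z ≈ [ ι , κ ] z
        v∘u∘[ι,κ] z = cong v {x = u ⟨$⟩ [ ι , κ ] z} {z} (u-spec z) D.∙ v-spec z

        v∘u : ∀ {i} (d : ∣ D ∣ i) → D ∋ v ⟨$⟩ u ⟨$⟩ d ≈ d
        v∘u d =
          let (_ , _ , _ , unique) = universal ι κ square
          in unique (v ∘ u) (λ _ a → v∘u∘[ι,κ] (inj₁ a)) (λ _ c → v∘u∘[ι,κ] (inj₂ c)) _ d
             D.∙ D.sym (unique id (λ _ _ → D.refl) (λ _ _ → D.refl) _ d)

  module _ {B A : PSh} {m : Hom B A} (regular : RegularMono m) where
    private
      module A = El A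
      module B = El B

    regular⇒injective : Injective m
    regular⇒injective {i} {x} {y} e =
      let (_ , _ , _ , (equalises , universal)) = regular
          (_ , _ , unique) = universal (m ∘ element B x) (λ _ h → equalises _ (res B h x))
          x≈u = unique (element B x) (λ _ _ → A.refl)
          y≈u = unique (element B y) (element-square m m (A.sym e))
      in element-injective B (λ j h → x≈u j h B.∙ B.sym (y≈u j h))

    -- B with the fuzziness induced along m still equalises, hence factors through B.
    regular⇒reflectsFuzziness : ReflectsFuzziness m
    regular⇒reflectsFuzziness {i} x =
      let (_ , _ , _ , (equalises , universal)) = regular
          (u , m∘u , _) = universal {Bᵐ} mᵐ equalises
      in L.trans (fuzzy u i x) (B.≈⇒α≤ (regular⇒injective (m∘u i x)))
      where
      Bᵐ : PSh
      Bᵐ = record B { α = λ i x → α A i (m ⟨$⟩ x) ; α-cong = λ i e → α-cong A i (cong m e) }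

      mᵐ : Hom Bᵐ A
      mᵐ = record { η = η m ; natural = natural m ; fuzzy = λ _ _ → L.refl }

  module _ {A' B' A B : PSh} {m' : Hom B' A'} {pB : Hom B' B} {pA : Hom A' A} {m : Hom B A}
           (pullback : IsPullbackᵉ m' pB pA m) where
    open IsPullbackᵉ pullback
    private module A = El A

    injective-pullback : Injective m → Injective m'
    injective-pullback m-injective {x = x} {y} e =
      jointly-injective x y e (m-injective (A.sym (commutes x) A.∙ cong pA e A.∙ commutes y))

    reflectsFuzziness-pullback : ReflectsFuzziness m → ReflectsFuzziness m'
    reflectsFuzziness-pullback m-reflects {i} x = L.trans
      (L.∧-greatest L.refl
        (L.trans (fuzzy pA i (m' ⟨$⟩ x)) (L.trans (A.≈⇒α≤ (commutes x)) (m-reflects (pB ⟨$⟩ x)))))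
      (α-meet x)

  module VanKampen
    {A B C D : PSh} (m : Hom B A) (g : Hom B C) (ι : Hom A D) (κ : Hom C D)
    (m-regular : RegularMono m) (bottom : IsPushout m g ι κ)
    {A' B' C' D' : PSh} (m' : Hom B' A') (g' : Hom B' C') (ι' : Hom A' D') (κ' : Hom C' D')
    (pA : Hom A' A) (pB : Hom B' B) (pC : Hom C' C) (pD : Hom D' D)
    (top-commutes : ι' ∘ m' ≈ κ' ∘ g')
    (ι-commutes : pD ∘ ι' ≈ ι ∘ pA) (κ-commutes : pD ∘ κ' ≈ κ ∘ pC)
    (back-m : IsPullback m' pB pA m) (back-g : IsPullback g' pB pC g) where
    private
      module A  = El A
      module C  = El C
      module D  = El D
      module A' = El A'
      module C' = El C'
      module D' = El D'
      module S  = Span m g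
      module S' = Span m' g'
      back-mᵉ : IsPullbackᵉ m' pB pA m
      back-mᵉ = IsPullback⇒ᵉ back-m

      back-gᵉ : IsPullbackᵉ g' pB pC g
      back-gᵉ = IsPullback⇒ᵉ back-g

      module BM = IsPullbackᵉ back-mᵉ
      module BG = IsPullbackᵉ back-gᵉ

      m-injective : Injective m
      m-injective = regular⇒injective {m = m} m-regular

      m-reflects : ReflectsFuzziness m
      m-reflects = regular⇒reflectsFuzziness {m = m} m-regular

      m'-injective : Injective m'
      m'-injective = injective-pullback back-mᵉ m-injective

      m'-reflects : ReflectsFuzziness m'
      m'-reflects = reflectsFuzziness-pullback back-mᵉ m-reflects

      bottomᵉ : S.IsPushoutᵉ ι κ
      bottomᵉ = S.Gluing.IsPushout⇒ᵉ m-injective bottom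

      module E = S.IsPushoutᵉ bottomᵉ

      π : ∀ {i} → S'.Sum i → S.Sum i
      π (inj₁ a') = inj₁ (pA ⟨$⟩ a')
      π (inj₂ c') = inj₂ (pC ⟨$⟩ c')

      π-commutes : ∀ {i} (z' : S'.Sum i) → D ∋ [ ι , κ ] (π z') ≈ pD ⟨$⟩ [ ι' , κ' ] z'
      π-commutes (inj₁ a') = D.sym (ι-commutes _ a')
      π-commutes (inj₂ c') = D.sym (κ-commutes _ c')

      glued'-coequalised : ∀ {i} {a' : ∣ A' ∣ i} {c'} → S'.Glued a' c' → D' ∋ ι' ⟨$⟩ a' ≈ κ' ⟨$⟩ c'
      glued'-coequalised = S'.glued-coequalised ι' κ' top-commutes

      lift-gluedᴬ : ∀ {i} (a' : ∣ A' ∣ i) {c} → S.Glued (pA ⟨$⟩ a') c →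
                    Σ (∣ C' ∣ i) λ c' → S'.Glued a' c' × C ∋ pC ⟨$⟩ c' ≈ c
      lift-gluedᴬ a' (b , mb , gb) =
        let (b' , m'b' , pBb') = BM.pair a' b (A.sym mb)
        in g' ⟨$⟩ b' , (b' , m'b' , C'.refl) , BG.commutes b' C.∙ cong g pBb' C.∙ gb

      lift-gluedᶜ : ∀ {i} (c' : ∣ C' ∣ i) {a} → S.Glued a (pC ⟨$⟩ c') →
                    Σ (∣ A' ∣ i) λ a' → S'.Glued a' c' × A ∋ pA ⟨$⟩ a' ≈ a
      lift-gluedᶜ c' (b , mb , gb) =
        let (b' , g'b' , pBb') = BG.pair c' b (C.sym gb)
        in m' ⟨$⟩ b' , (b' , A'.refl , g'b') , BM.commutes b' A.∙ cong m pBb' A.∙ mb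

      glued'-α≤ : ∀ {i} {a' : ∣ A' ∣ i} {c'} → S'.Glued a' c' → α A' i a' L.≤ α C' i c'
      glued'-α≤ {i} (b' , m'b' , g'b') =
        L.trans (A'.≈⇒α≤ (A'.sym m'b'))
          (L.trans (m'-reflects b') (L.trans (fuzzy g' i b') (C'.≈⇒α≤ g'b')))

      glued'-α-meet : ∀ {i} {a' : ∣ A' ∣ i} {c'} → S'.Glued a' c' →
                      α C' i c' L.∧ α A i (pA ⟨$⟩ a') L.≤ α A' i a'
      glued'-α-meet {i} (b' , m'b' , g'b') =
        L.trans (L.∧-monotonic (C'.≈⇒α≤ (C'.sym g'b'))
                               (L.trans (A.≈⇒α≤ (cong pA (A'.sym m'b') A.∙ BM.commutes b'))
                                        (m-reflects (pB ⟨$⟩ b'))))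
          (L.trans (BG.α-meet b') (L.trans (fuzzy m' i b') (A'.≈⇒α≤ m'b')))

    front⇒top : IsPullback ι' pA pD ι × IsPullback κ' pC pD κ → IsPushout m' g' ι' κ'
    front⇒top (front-ι , front-κ) = S'.ᵉ⇒IsPushout record
      { commutes           = λ {i} → top-commutes i
      ; jointly-surjective = λ d' →
          let (z , e) = E.jointly-surjective (pD ⟨$⟩ d')
              (z' , e' , _) = lift d' z e
          in z' , e'
      ; kernel⊆∼           = λ z₁ z₂ e → lift-∼ z₁ z₂ e
          (E.kernel⊆∼ (π z₁) (π z₂) (π-commutes z₁ D.∙ cong pD e D.∙ D.sym (π-commutes z₂)))
      -- α D' d' ∧ - preserves the join that defines α D (pD d'); this needs ⇨.
      ; α-join             = λ {i} d' y bound →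
          L.trans (L.∧-greatest (fuzzy pD i d') L.refl)
            (L.transpose-∧ (E.α-join (pD ⟨$⟩ d') _ λ z e →
              let (z' , e' , α≤) = lift d' z e
              in L.swap-transpose-⇨ (L.trans α≤ (bound z' e'))))
      }
      where
      front-ιᵉ : IsPullbackᵉ ι' pA pD ι
      front-ιᵉ = IsPullback⇒ᵉ front-ι

      front-κᵉ : IsPullbackᵉ κ' pC pD κ
      front-κᵉ = IsPullback⇒ᵉ front-κ

      module FI = IsPullbackᵉ front-ιᵉ
      module FK = IsPullbackᵉ front-κᵉ

      lift : ∀ {i} (d' : ∣ D' ∣ i) (z : S.Sum i) → D ∋ [ ι , κ ] z ≈ pD ⟨$⟩ d' →
             Σ (S'.Sum i) λ z' → D' ∋ [ ι' , κ' ] z' ≈ d' × α D' i d' L.∧ S.α⊎ z L.≤ S'.α⊎ z'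
      lift d' (inj₁ a) e =
        let (a' , ι'a' , pAa') = FI.pair d' a (D.sym e)
        in inj₁ a' , ι'a' ,
           L.trans (L.∧-monotonic (D'.≈⇒α≤ (D'.sym ι'a')) (A.≈⇒α≤ (A.sym pAa'))) (FI.α-meet a')
      lift d' (inj₂ c) e =
        let (c' , κ'c' , pCc') = FK.pair d' c (D.sym e)
        in inj₂ c' , κ'c' ,
           L.trans (L.∧-monotonic (D'.≈⇒α≤ (D'.sym κ'c')) (C.≈⇒α≤ (C.sym pCc'))) (FK.α-meet c')

      lift-glued : ∀ {i} (a' : ∣ A' ∣ i) (c' : ∣ C' ∣ i) → D' ∋ ι' ⟨$⟩ a' ≈ κ' ⟨$⟩ c' →
                   S.Glued (pA ⟨$⟩ a') (pC ⟨$⟩ c') → S'.Glued a' c'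
      lift-glued a' c' e gl =
        let (c'' , gl' , pCc'') = lift-gluedᴬ a' gl
            c''≈c' = FK.jointly-injective c'' c' (D'.sym (glued'-coequalised gl') D'.∙ e) pCc''
        in S'.glued-respʳ c''≈c' gl'

      lift-∼ : ∀ {i} (z₁ z₂ : S'.Sum i) → D' ∋ [ ι' , κ' ] z₁ ≈ [ ι' , κ' ] z₂ →
               π z₁ S.∼ π z₂ → z₁ S'.∼ z₂
      lift-∼ (inj₁ a₁) (inj₁ a₂) e (inj₁ p) = inj₁ (FI.jointly-injective a₁ a₂ e p)
      lift-∼ (inj₁ a₁) (inj₁ a₂) e (inj₂ (c , gl₁ , gl₂)) =
        let (c₁ , gl₁' , pCc₁) = lift-gluedᴬ a₁ gl₁
            (c₂ , gl₂' , pCc₂) = lift-gluedᴬ a₂ gl₂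
            c₁≈c₂ = FK.jointly-injective c₁ c₂
                      (D'.sym (glued'-coequalised gl₁') D'.∙ e D'.∙ glued'-coequalised gl₂')
                      (pCc₁ C.∙ C.sym pCc₂)
        in inj₂ (c₁ , gl₁' , S'.glued-respʳ (C'.sym c₁≈c₂) gl₂')
      lift-∼ (inj₁ a') (inj₂ c') e gl = lift-glued a' c' e gl
      lift-∼ (inj₂ c') (inj₁ a') e gl = lift-glued a' c' (D'.sym e) gl
      lift-∼ (inj₂ c₁) (inj₂ c₂) e p  = FK.jointly-injective c₁ c₂ e p

    top⇒front : IsPushout m' g' ι' κ' → IsPullback ι' pA pD ι × IsPullback κ' pC pD κ
    top⇒front top = ᵉ⇒IsPullback front-ι , ᵉ⇒IsPullback front-κ
      where
      topᵉ : S'.IsPushoutᵉ ι' κ'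
      topᵉ = S'.Gluing.IsPushout⇒ᵉ m'-injective top

      module T = S'.IsPushoutᵉ topᵉ

      lift : ∀ {i} (d' : ∣ D' ∣ i) (z : S.Sum i) → D ∋ pD ⟨$⟩ d' ≈ [ ι , κ ] z →
             Σ (S'.Sum i) λ z' → D' ∋ [ ι' , κ' ] z' ≈ d' × π z' S.∼ z
      lift d' z e =
        let (z' , e') = T.jointly-surjective d'
        in z' , e' , E.kernel⊆∼ (π z') z (π-commutes z' D.∙ cong pD e' D.∙ e)

      ι-jointly-injective : ∀ {i} (x y : ∣ A' ∣ i) →
                            D' ∋ ι' ⟨$⟩ x ≈ ι' ⟨$⟩ y → A ∋ pA ⟨$⟩ x ≈ pA ⟨$⟩ y → A' ∋ x ≈ y
      ι-jointly-injective x y e p with T.kernel⊆∼ (inj₁ x) (inj₁ y) e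
      ... | inj₁ x≈y = x≈y
      ... | inj₂ (_ , (b₁ , m'b₁ , g'b₁) , (b₂ , m'b₂ , g'b₂)) =
        let pBb₁≈pBb₂ = m-injective (A.sym (BM.commutes b₁) A.∙ cong pA m'b₁ A.∙ p
                                     A.∙ A.sym (cong pA m'b₂) A.∙ BM.commutes b₂)
            b₁≈b₂     = BG.jointly-injective b₁ b₂ (g'b₁ C'.∙ C'.sym g'b₂) pBb₁≈pBb₂
        in A'.sym m'b₁ A'.∙ cong m' b₁≈b₂ A'.∙ m'b₂

      ι-pair : ∀ {i} {d' : ∣ D' ∣ i} {a} (z' : S'.Sum i) → D' ∋ [ ι' , κ' ] z' ≈ d' →
               π z' S.∼ inj₁ a → Σ (∣ A' ∣ i) λ x → D' ∋ ι' ⟨$⟩ x ≈ d' × A ∋ pA ⟨$⟩ x ≈ a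
      ι-pair (inj₁ a') e (inj₁ p) = a' , e , p
      ι-pair (inj₁ a') e (inj₂ (c , gl₁ , gl₂)) =
        let (c' , gl' , pCc') = lift-gluedᴬ a' gl₁
            (x , glx , pAx) = lift-gluedᶜ c' (S.glued-respʳ (C.sym pCc') gl₂)
        in x , glued'-coequalised glx D'.∙ D'.sym (glued'-coequalised gl') D'.∙ e , pAx
      ι-pair (inj₂ c') e gl =
        let (x , glx , pAx) = lift-gluedᶜ c' gl
        in x , glued'-coequalised glx D'.∙ e , pAx

      ι-fibre-bound : ∀ {i} (x : ∣ A' ∣ i) (z : S'.Sum i) → z S'.∼ inj₁ x →
                      S'.α⊎ z L.∧ α A i (pA ⟨$⟩ x) L.≤ α A' i x
      ι-fibre-bound x (inj₁ _) (inj₁ p)              = L.trans (L.x∧y≤x _ _) (A'.≈⇒α≤ p)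
      ι-fibre-bound x (inj₁ _) (inj₂ (_ , gl , gl')) =
        L.trans (L.∧-monotonic (glued'-α≤ gl) L.refl) (glued'-α-meet gl')
      ι-fibre-bound x (inj₂ _) gl = glued'-α-meet gl

      front-ι : IsPullbackᵉ ι' pA pD ι
      front-ι = record
        { commutes          = λ {i} → ι-commutes i
        ; jointly-injective = ι-jointly-injective
        ; pair              = λ d' a e → let (z' , e' , r) = lift d' (inj₁ a) e in ι-pair z' e' r
        ; α-meet            = λ x → L.transpose-∧ (T.α-join (ι' ⟨$⟩ x) _ λ z e →
            L.transpose-⇨ (ι-fibre-bound x z (T.kernel⊆∼ z (inj₁ x) e)))
        }

      κ-pair : ∀ {i} {d' : ∣ D' ∣ i} {c} (z' : S'.Sum i) → D' ∋ [ ι' , κ' ] z' ≈ d' →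
               π z' S.∼ inj₂ c → Σ (∣ C' ∣ i) λ y → D' ∋ κ' ⟨$⟩ y ≈ d' × C ∋ pC ⟨$⟩ y ≈ c
      κ-pair (inj₁ a') e gl =
        let (c' , gl' , pCc') = lift-gluedᴬ a' gl
        in c' , D'.sym (glued'-coequalised gl') D'.∙ e , pCc'
      κ-pair (inj₂ c') e p = c' , e , p

      κ-fibre-bound : ∀ {i} (y : ∣ C' ∣ i) (z : S'.Sum i) → z S'.∼ inj₂ y → S'.α⊎ z L.≤ α C' i y
      κ-fibre-bound y (inj₁ _) gl = glued'-α≤ gl
      κ-fibre-bound y (inj₂ _) p  = C'.≈⇒α≤ p

      front-κ : IsPullbackᵉ κ' pC pD κ
      front-κ = record
        { commutes          = λ {i} → κ-commutes i
        ; jointly-injective = λ x y e _ → T.kernel⊆∼ (inj₂ x) (inj₂ y) e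
        ; pair              = λ d' c e → let (z' , e' , r) = lift d' (inj₂ c) e in κ-pair z' e' r
        ; α-meet            = λ y → L.trans (L.x∧y≤x _ _) (T.α-join (κ' ⟨$⟩ y) _ λ z e →
            κ-fibre-bound y z (T.kernel⊆∼ z (inj₂ y) e))
        }

  pushoutAlongRegularMono : ∀ {A B C} (m : Hom B A) (g : Hom B C) → RegularMono m →
                            Σ PSh λ D → Σ (Hom A D) λ ι → Σ (Hom C D) λ κ → IsPushout m g ι κ
  pushoutAlongRegularMono m g m-regular =
    Span.Gluing.pushout m g (regular⇒injective {m = m} m-regular)

  regularPushout⇒vanKampen : ∀ {A B C D} (m : Hom B A) (g : Hom B C) (ι : Hom A D) (κ : Hom C D) →
                             RegularMono m → IsPushout m g ι κ → IsVanKampen m g ι κ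
  regularPushout⇒vanKampen m g ι κ m-regular bottom
    m' g' ι' κ' pA pB pC pD top _ _ ι-commutes κ-commutes back-m back-g =
    mk⇔ front⇒top top⇒front
    where open VanKampen m g ι κ m-regular bottom m' g' ι' κ' pA pB pC pD
                         top ι-commutes κ-commutes back-m back-g

theorem42 : (I : Category 0ℓ 0ℓ 0ℓ)
            (L : Category.Obj I → CompleteHeytingAlgebra 0ℓ 0ℓ 0ℓ) →
            CatNotions.RmAdhesive (FuzzyPresheafCat I L)
theorem42 I L = pushoutAlongRegularMono I L , regularPushout⇒vanKampen I L
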